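{- Let $\mathbf U=\langle\langle U,\approx\rangle,\preceq\rangle$ be an $\mathbf L$-ordered set and $M\subseteq L^U$ a subset containing only convex $\mathbf L$-sets in $\mathbf U$. Then $\langle\langle M,\approx^{+}\rangle,\preceq^{+}\rangle$ (the power relations restricted to $M$) is an $\mathbf L$-ordered set.
   Context: $\mathbf L=\langle L,\wedge,\vee,\otimes,\to,0,1\rangle$ is a complete residuated lattice ($\langle L,\wedge,\vee,0,1\rangle$ complete lattice, $\langle L,\otimes,1\rangle$ commutative monoid, $a\otimes b\le c$ iff $a\le b\to c$). An $\mathbf L$-set in $X$ is a map $X\to L$; $L^X$ the set of them; $A\subseteq B$ iff $A(x)\le B(x)$ for all $x$; $\cap$ is pointwise $\wedge$; $S(A,B)=\bigwedge_x(A(x)\to B(x))$. An $\mathbf L$-equality on $X$ is a binary $\mathbf L$-relation (map $X\times X\to L$) that is reflexive, symmetric, transitive ($R(x,y)\otimes R(y,z)\le R(x,z)$) and with $R(x,y)=1\Rightarrow x=y$. An $\mathbf L$-ordered set is $\langle\langle U,\approx\rangle,\preceq\rangle$ with $\approx$ an $\mathbf L$-equality and $\preceq$ a reflexive, transitive binary $\mathbf L$-relation compatible with $\approx$ (i.e. $(u\preceq v)\otimes(u\approx u')\otimes(v\approx v')\le(u'\preceq v')$) and with $(u\preceq v)\wedge(v\preceq u)\le u\approx v$. For $V\in L^U$: $\downarrow V(u)=\bigvee_{v}(u\preceq v)\otimes V(v)$, $\uparrow V(u)=\bigvee_v(v\preceq u)\otimes V(v)$; $V$ is convex if $V=\downarrow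 V\cap\uparrow V$. For a binary $\mathbf L$-relation $R$ on a set $X$ and $A,B\in L^X$: $(R\circ B)(x)=\bigvee_y R(x,y)\otimes B(y)$, $(A\circ R)(y)=\bigvee_x A(x)\otimes R(x,y)$, $R^+(A,B)=S(A,R\circ B)\wedge S(B,A\circ R)$. -}

module Defs where

open import Level using (0ℓ)
open import Data.Product using (Σ; proj₁; _×_)
open import Relation.Binary.PropositionalEquality using (_≡_)

record CRL : Set₁ where
  infixr 6 _∧_ _∨_
  infixr 7 _⊗_
  infixr 5 _⇒_
  infix 4 _≤_
  field
    Carrier : Set
    _≤_     : Carrier → Carrier → Set
    ≤-refl    : ∀ a → a ≤ a
    ≤-trans   : ∀ {a b c} → a ≤ b → b ≤ c → a ≤ c
    ≤-antisym : ∀ {a b} → a ≤ b → b ≤ a → a ≡ b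
    ⋀ : {I : Set} → (I → Carrier) → Carrier
    ⋁ : {I : Set} → (I → Carrier) → Carrier
    ⋀-lb   : ∀ {I} (f : I → Carrier) i → ⋀ f ≤ f i
    ⋀-glb  : ∀ {I} (f : I → Carrier) a → (∀ i → a ≤ f i) → a ≤ ⋀ f
    ⋁-ub   : ∀ {I} (f : I → Carrier) i → f i ≤ ⋁ f
    ⋁-lub  : ∀ {I} (f : I → Carrier) a → (∀ i → f i ≤ a) → ⋁ f ≤ a
    _∧_ _∨_ : Carrier → Carrier → Carrier
    ∧-lb₁ : ∀ a b → a ∧ b ≤ a
    ∧-lb₂ : ∀ a b → a ∧ b ≤ b
    ∧-glb : ∀ {a b c} → c ≤ a → c ≤ b → c ≤ a ∧ b
    ∨-ub₁ : ∀ a b → a ≤ a ∨ b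
    ∨-ub₂ : ∀ a b → b ≤ a ∨ b
    ∨-lub : ∀ {a b c} → a ≤ c → b ≤ c → a ∨ b ≤ c
    𝟘 𝟙 : Carrier
    𝟘-min : ∀ a → 𝟘 ≤ a
    𝟙-max : ∀ a → a ≤ 𝟙
    _⊗_ : Carrier → Carrier → Carrier
    ⊗-assoc : ∀ a b c → (a ⊗ b) ⊗ c ≡ a ⊗ (b ⊗ c)
    ⊗-comm  : ∀ a b → a ⊗ b ≡ b ⊗ a
    ⊗-identityˡ : ∀ a → 𝟙 ⊗ a ≡ a
    _⇒_ : Carrier → Carrier → Carrier
    adj⇒ : ∀ {a b c} → a ⊗ b ≤ c → a ≤ b ⇒ c
    adj⇐ : ∀ {a b c} → a ≤ b ⇒ c → a ⊗ b ≤ c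

module _ (𝐋 : CRL) where
  open CRL 𝐋

  LSet : Set → Set
  LSet X = X → Carrier

  _≗ᴸ_ : ∀ {X} → LSet X → LSet X → Set
  A ≗ᴸ B = ∀ x → A x ≡ B x

  _∩_ : ∀ {X} → LSet X → LSet X → LSet X
  (A ∩ B) x = A x ∧ B x

  S : ∀ {X} → LSet X → LSet X → Carrier
  S A B = ⋀ (λ x → A x ⇒ B x)

  _∘ʳ_ : ∀ {X} → (X → X → Carrier) → LSet X → LSet X
  (R ∘ʳ B) x = ⋁ (λ y → R x y ⊗ B y)

  _ʳ∘_ : ∀ {X} → LSet X → (X → X → Carrier) → LSet X
  (A ʳ∘ R) y = ⋁ (λ x → A x ⊗ R x y)

  _⁺ : ∀ {X} → (X → X → Carrier) → LSet X → LSet X → Carrier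
  (R ⁺) A B = S A (R ∘ʳ B) ∧ S B (A ʳ∘ R)

  record IsLEquality {X : Set} (_≐_ : X → X → Set) (E : X → X → Carrier) : Set where
    field
      refl  : ∀ x → E x x ≡ 𝟙
      sym   : ∀ x y → E x y ≡ E y x
      trans : ∀ x y z → E x y ⊗ E y z ≤ E x z
      sep   : ∀ x y → E x y ≡ 𝟙 → x ≐ y

  -- L-ordered set ⟨⟨X, E⟩, P⟩  (E plays ≈, P plays ≼)
  record IsLOrdered {X : Set} (_≐_ : X → X → Set)
                    (E P : X → X → Carrier) : Set where
    field
      isLEquality : IsLEquality _≐_ E
      refl    : ∀ x → P x x ≡ 𝟙
      trans   : ∀ x y z → P x y ⊗ P y z ≤ P x z
      compat  : ∀ u v u′ v′ → P u v ⊗ E u u′ ⊗ E v v′ ≤ P u′ v′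
      antisym : ∀ u v → P u v ∧ P v u ≤ E u v

  ↓ : ∀ {X} → (X → X → Carrier) → LSet X → LSet X
  ↓ P V u = ⋁ (λ v → P u v ⊗ V v)

  ↑ : ∀ {X} → (X → X → Carrier) → LSet X → LSet X
  ↑ P V u = ⋁ (λ v → P v u ⊗ V v)

  Convex : ∀ {X} → (X → X → Carrier) → LSet X → Set
  Convex P V = V ≗ᴸ (↓ P V ∩ ↑ P V)

-- Since ≈ lies below
-- both ≼ and its converse, composing a convex set with ≈ cannot enlarge it, which
-- turns A ≈⁺ B = 1 into A = B.  Likewise A ≼⁺ B ∧ B ≼⁺ A bounds the degree to which
-- A is included in ↓B ∩ ↑B = B and B in ↓A ∩ ↑A = A, which gives antisymmetry.
-- The remaining axioms hold for the power relations on arbitrary L-sets.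
module Submission where

open import Defs
open import Data.Product using (Σ; _,_; proj₁)
open import Function using (flip)
open import Relation.Binary.Bundles using (Poset)
open import Relation.Binary.PropositionalEquality
  using (_≡_; refl; sym; cong; isEquivalence)
import Relation.Binary.Reasoning.PartialOrder as PosetReasoning

module Residuated (𝐋 : CRL) where
  open CRL 𝐋

  ≡⇒≤ : ∀ {a b} → a ≡ b → a ≤ b
  ≡⇒≤ refl = ≤-refl _

  poset : Poset _ _ _
  poset = record
    { Carrier = Carrier
    ; _≈_ = _≡_
    ; _≤_ = _≤_
    ; isPartialOrder = record
      { isPreorder = record
        { isEquivalence = isEquivalence
        ; reflexive = ≡⇒≤
        ; trans = ≤-trans
        }
      ; antisym = ≤-antisym
      }
    }

  open PosetReasoning poset public

  ⊗-monoˡ : ∀ {b b′} a → b ≤ b′ → b ⊗ a ≤ b′ ⊗ a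
  ⊗-monoˡ {b′ = b′} a b≤b′ = adj⇐ (≤-trans b≤b′ (adj⇒ (≤-refl (b′ ⊗ a))))

  ⊗-monoʳ : ∀ {b b′} a → b ≤ b′ → a ⊗ b ≤ a ⊗ b′
  ⊗-monoʳ {b} {b′} a b≤b′ = begin
    a ⊗ b   ≡⟨ ⊗-comm a b ⟩
    b ⊗ a   ≤⟨ ⊗-monoˡ a b≤b′ ⟩
    b′ ⊗ a  ≡⟨ ⊗-comm b′ a ⟩
    a ⊗ b′  ∎

  ⊗-mono : ∀ {a a′ b b′} → a ≤ a′ → b ≤ b′ → a ⊗ b ≤ a′ ⊗ b′
  ⊗-mono {a′ = a′} {b = b} a≤a′ b≤b′ = ≤-trans (⊗-monoˡ b a≤a′) (⊗-monoʳ a′ b≤b′)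

  ⊗-swap : ∀ a b c → a ⊗ (b ⊗ c) ≡ b ⊗ (a ⊗ c)
  ⊗-swap a b c = begin-equality
    a ⊗ (b ⊗ c)  ≡⟨ ⊗-assoc a b c ⟨
    (a ⊗ b) ⊗ c  ≡⟨ cong (_⊗ c) (⊗-comm a b) ⟩
    (b ⊗ a) ⊗ c  ≡⟨ ⊗-assoc b a c ⟩
    b ⊗ (a ⊗ c)  ∎

  ⋁-mono : ∀ {I : Set} {f g : I → Carrier} → (∀ i → f i ≤ g i) → ⋁ f ≤ ⋁ g
  ⋁-mono {g = g} f≤g = ⋁-lub _ _ (λ i → ≤-trans (f≤g i) (⋁-ub g i))

  ⋁-⊗-comm : ∀ {I : Set} (f g : I → Carrier) → ⋁ (λ i → f i ⊗ g i) ≤ ⋁ (λ i → g i ⊗ f i)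
  ⋁-⊗-comm f g = ⋁-mono (λ i → ≡⇒≤ (⊗-comm (f i) (g i)))

  ⊗-distribˡ-⋁ : ∀ {I : Set} a (f : I → Carrier) → a ⊗ ⋁ f ≤ ⋁ (λ i → a ⊗ f i)
  ⊗-distribˡ-⋁ a f = begin
    a ⊗ ⋁ f  ≡⟨ ⊗-comm a (⋁ f) ⟩
    ⋁ f ⊗ a  ≤⟨ adj⇐ (⋁-lub f _ (λ i → adj⇒ (≤-trans (≡⇒≤ (⊗-comm (f i) a))
                                                       (⋁-ub (λ i → a ⊗ f i) i)))) ⟩
    ⋁ (λ i → a ⊗ f i)  ∎

  module _ {X : Set} where

    S-intro : ∀ {a} {A B : LSet 𝐋 X} → (∀ x → a ⊗ A x ≤ B x) → a ≤ S 𝐋 A B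
    S-intro a⊗A≤B = ⋀-glb _ _ (λ x → adj⇒ (a⊗A≤B x))

    S-elim : ∀ {a} {A B : LSet 𝐋 X} → a ≤ S 𝐋 A B → ∀ x → a ⊗ A x ≤ B x
    S-elim a≤S x = adj⇐ (≤-trans a≤S (⋀-lb _ x))

    S-monoʳ : ∀ {A B B′ : LSet 𝐋 X} → (∀ x → B x ≤ B′ x) → S 𝐋 A B ≤ S 𝐋 A B′
    S-monoʳ B≤B′ = S-intro (λ x → ≤-trans (S-elim (≤-refl _) x) (B≤B′ x))

    S-∩ : ∀ {a} {A B C : LSet 𝐋 X} → a ≤ S 𝐋 A B → a ≤ S 𝐋 A C → a ≤ S 𝐋 A (_∩_ 𝐋 B C)
    S-∩ a≤SAB a≤SAC = S-intro (λ x → ∧-glb (S-elim a≤SAB x) (S-elim a≤SAC x))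

    𝟙≤S⇒⊆ : ∀ {A B : LSet 𝐋 X} → 𝟙 ≤ S 𝐋 A B → ∀ x → A x ≤ B x
    𝟙≤S⇒⊆ {A} 𝟙≤S x = ≤-trans (≡⇒≤ (sym (⊗-identityˡ (A x)))) (S-elim 𝟙≤S x)

module PowerRelation (𝐋 : CRL) {X : Set} where
  open CRL 𝐋
  open Residuated 𝐋

  private
    Rel : Set
    Rel = X → X → Carrier

  ʳ∘⊆flip-∘ʳ : ∀ (R : Rel) A x → _ʳ∘_ 𝐋 A R x ≤ _∘ʳ_ 𝐋 (flip R) A x
  ʳ∘⊆flip-∘ʳ R A x = ⋁-⊗-comm A (λ y → R y x)

  flip-∘ʳ⊆ʳ∘ : ∀ (R : Rel) A x → _∘ʳ_ 𝐋 (flip R) A x ≤ _ʳ∘_ 𝐋 A R x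
  flip-∘ʳ⊆ʳ∘ R A x = ⋁-⊗-comm (λ y → R y x) A

  ∘ʳ-monoˡ : ∀ {R R′ : Rel} → (∀ x y → R x y ≤ R′ x y) → ∀ A x → _∘ʳ_ 𝐋 R A x ≤ _∘ʳ_ 𝐋 R′ A x
  ∘ʳ-monoˡ R≤R′ A x = ⋁-mono (λ y → ⊗-monoˡ (A y) (R≤R′ x y))

  ⊆-∘ʳ : ∀ {R : Rel} → (∀ x → R x x ≡ 𝟙) → ∀ A x → A x ≤ _∘ʳ_ 𝐋 R A x
  ⊆-∘ʳ {R} R-refl A x = begin
    A x         ≡⟨ ⊗-identityˡ (A x) ⟨
    𝟙 ⊗ A x     ≡⟨ cong (_⊗ A x) (R-refl x) ⟨
    R x x ⊗ A x ≤⟨ ⋁-ub (λ y → R x y ⊗ A y) x ⟩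
    _∘ʳ_ 𝐋 R A x ∎

  ⊆-ʳ∘ : ∀ {R : Rel} → (∀ x → R x x ≡ 𝟙) → ∀ A x → A x ≤ _ʳ∘_ 𝐋 A R x
  ⊆-ʳ∘ {R} R-refl A x = ≤-trans (⊆-∘ʳ {flip R} R-refl A x) (flip-∘ʳ⊆ʳ∘ R A x)

  S-∘ʳ-trans : ∀ {R : Rel} → (∀ x y z → R x y ⊗ R y z ≤ R x z) →
               ∀ A B C → S 𝐋 A (_∘ʳ_ 𝐋 R B) ⊗ S 𝐋 B (_∘ʳ_ 𝐋 R C) ≤ S 𝐋 A (_∘ʳ_ 𝐋 R C)
  S-∘ʳ-trans {R} R-trans A B C = S-intro λ x → begin
    (s ⊗ t) ⊗ A x  ≡⟨ ⊗-assoc s t (A x) ⟩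
    s ⊗ (t ⊗ A x)  ≡⟨ ⊗-swap s t (A x) ⟩
    t ⊗ (s ⊗ A x)  ≤⟨ ⊗-monoʳ t (S-elim (≤-refl s) x) ⟩
    t ⊗ R∘ B x     ≤⟨ ⊗-distribˡ-⋁ t _ ⟩
    ⋁ (λ y → t ⊗ (R x y ⊗ B y))  ≤⟨ ⋁-lub _ _ (through x) ⟩
    R∘ C x         ∎
    where
    R∘ : LSet 𝐋 X → LSet 𝐋 X
    R∘ = _∘ʳ_ 𝐋 R
    s t : Carrier
    s = S 𝐋 A (R∘ B)
    t = S 𝐋 B (R∘ C)
    through : ∀ x y → t ⊗ (R x y ⊗ B y) ≤ R∘ C x
    through x y = begin
      t ⊗ (R x y ⊗ B y)  ≡⟨ ⊗-swap t (R x y) (B y) ⟩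
      R x y ⊗ (t ⊗ B y)  ≤⟨ ⊗-monoʳ (R x y) (S-elim (≤-refl t) y) ⟩
      R x y ⊗ R∘ C y     ≤⟨ ⊗-distribˡ-⋁ (R x y) _ ⟩
      ⋁ (λ z → R x y ⊗ (R y z ⊗ C z))
        ≤⟨ ⋁-mono (λ z → ≤-trans (≡⇒≤ (sym (⊗-assoc (R x y) (R y z) (C z))))
                                 (⊗-monoˡ (C z) (R-trans x y z))) ⟩
      R∘ C x             ∎

  S-ʳ∘-trans : ∀ {R : Rel} → (∀ x y z → R x y ⊗ R y z ≤ R x z) →
               ∀ A B C → S 𝐋 B (_ʳ∘_ 𝐋 A R) ⊗ S 𝐋 C (_ʳ∘_ 𝐋 B R) ≤ S 𝐋 C (_ʳ∘_ 𝐋 A R)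
  S-ʳ∘-trans {R} R-trans A B C = begin
    S 𝐋 B (A ʳ∘R) ⊗ S 𝐋 C (B ʳ∘R)
      ≤⟨ ⊗-mono (S-monoʳ (ʳ∘⊆flip-∘ʳ R A)) (S-monoʳ (ʳ∘⊆flip-∘ʳ R B)) ⟩
    S 𝐋 B (R⁻¹∘ A) ⊗ S 𝐋 C (R⁻¹∘ B)  ≡⟨ ⊗-comm _ _ ⟩
    S 𝐋 C (R⁻¹∘ B) ⊗ S 𝐋 B (R⁻¹∘ A)
      ≤⟨ S-∘ʳ-trans (λ x y z → ≤-trans (≡⇒≤ (⊗-comm (R y x) (R z y))) (R-trans z y x)) C B A ⟩
    S 𝐋 C (R⁻¹∘ A)  ≤⟨ S-monoʳ (flip-∘ʳ⊆ʳ∘ R A) ⟩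
    S 𝐋 C (A ʳ∘R)   ∎
    where
    _ʳ∘R : LSet 𝐋 X → LSet 𝐋 X
    A′ ʳ∘R = _ʳ∘_ 𝐋 A′ R
    R⁻¹∘ : LSet 𝐋 X → LSet 𝐋 X
    R⁻¹∘ = _∘ʳ_ 𝐋 (flip R)

  ⁺-refl : ∀ {R : Rel} → (∀ x → R x x ≡ 𝟙) → ∀ A → _⁺ 𝐋 R A A ≡ 𝟙
  ⁺-refl R-refl A = ≤-antisym (𝟙-max _)
    (∧-glb (S-intro (λ x → ≤-trans (≡⇒≤ (⊗-identityˡ (A x))) (⊆-∘ʳ R-refl A x)))
           (S-intro (λ x → ≤-trans (≡⇒≤ (⊗-identityˡ (A x))) (⊆-ʳ∘ R-refl A x))))

  ⁺-trans : ∀ {R : Rel} → (∀ x y z → R x y ⊗ R y z ≤ R x z) →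
            ∀ A B C → _⁺ 𝐋 R A B ⊗ _⁺ 𝐋 R B C ≤ _⁺ 𝐋 R A C
  ⁺-trans R-trans A B C = ∧-glb
    (≤-trans (⊗-mono (∧-lb₁ _ _) (∧-lb₁ _ _)) (S-∘ʳ-trans R-trans A B C))
    (≤-trans (⊗-mono (∧-lb₂ _ _) (∧-lb₂ _ _)) (S-ʳ∘-trans R-trans A B C))

  ⁺-flip : ∀ (R : Rel) A B → _⁺ 𝐋 R A B ≤ _⁺ 𝐋 (flip R) B A
  ⁺-flip R A B = ∧-glb
    (≤-trans (∧-lb₂ _ _) (S-monoʳ (ʳ∘⊆flip-∘ʳ R A)))
    (≤-trans (∧-lb₁ _ _) (S-monoʳ (flip-∘ʳ⊆ʳ∘ (flip R) B)))

  ⁺-mono : ∀ {R R′ : Rel} → (∀ x y → R x y ≤ R′ x y) → ∀ A B → _⁺ 𝐋 R A B ≤ _⁺ 𝐋 R′ A B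
  ⁺-mono R≤R′ A B = ∧-glb
    (≤-trans (∧-lb₁ _ _) (S-monoʳ (∘ʳ-monoˡ R≤R′ B)))
    (≤-trans (∧-lb₂ _ _) (S-monoʳ (λ x → ⋁-mono (λ y → ⊗-monoʳ (A y) (R≤R′ y x)))))

  ⁺-sym : ∀ {R : Rel} → (∀ x y → R x y ≡ R y x) → ∀ A B → _⁺ 𝐋 R A B ≡ _⁺ 𝐋 R B A
  ⁺-sym {R} R-sym A B = ≤-antisym (flipped A B) (flipped B A)
    where
    flipped : ∀ A B → _⁺ 𝐋 R A B ≤ _⁺ 𝐋 R B A
    flipped A B = ≤-trans (⁺-flip R A B) (⁺-mono (λ x y → ≡⇒≤ (R-sym y x)) B A)

module ConvexSets (𝐋 : CRL) {U : Set} {E P : U → U → CRL.Carrier 𝐋}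
                  (ord : IsLOrdered 𝐋 {U} _≡_ E P) where
  open CRL 𝐋
  open Residuated 𝐋
  open PowerRelation 𝐋
  open IsLOrdered ord using (isLEquality; compat)
    renaming (refl to P-refl; trans to P-trans)
  open IsLEquality isLEquality using () renaming (refl to E-refl; sym to E-sym)

  E≤P : ∀ x y → E x y ≤ P x y
  E≤P x y = begin
    E x y                 ≡⟨ ⊗-identityˡ (E x y) ⟨
    𝟙 ⊗ E x y             ≡⟨ ⊗-identityˡ (𝟙 ⊗ E x y) ⟨
    𝟙 ⊗ 𝟙 ⊗ E x y         ≡⟨ cong (λ p → p ⊗ 𝟙 ⊗ E x y) (P-refl x) ⟨
    P x x ⊗ 𝟙 ⊗ E x y     ≡⟨ cong (λ e → P x x ⊗ e ⊗ E x y) (E-refl x) ⟨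
    P x x ⊗ E x x ⊗ E x y ≤⟨ compat x x x y ⟩
    P x y                 ∎

  E≤flipP : ∀ x y → E x y ≤ P y x
  E≤flipP x y = ≤-trans (≡⇒≤ (E-sym x y)) (E≤P y x)

  convex-∘ʳ-⊆ : ∀ {R : U → U → Carrier} →
                (∀ x y → R x y ≤ P x y) → (∀ x y → R x y ≤ P y x) →
                ∀ {V} → Convex 𝐋 P V → ∀ x → _∘ʳ_ 𝐋 R V x ≤ V x
  convex-∘ʳ-⊆ {R} R≤P R≤flipP {V} V-convex x = begin
    _∘ʳ_ 𝐋 R V x               ≤⟨ ∧-glb (∘ʳ-monoˡ R≤P V x) (∘ʳ-monoˡ R≤flipP V x) ⟩
    ↓ 𝐋 P V x ∧ ↑ 𝐋 P V x      ≡⟨ V-convex x ⟨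
    V x                        ∎

  convex-ʳ∘-⊆ : ∀ {V} → Convex 𝐋 P V → ∀ x → _ʳ∘_ 𝐋 V E x ≤ V x
  convex-ʳ∘-⊆ V-convex x = ≤-trans (ʳ∘⊆flip-∘ʳ E _ x)
    (convex-∘ʳ-⊆ (λ x y → E≤flipP y x) (λ x y → E≤P y x) V-convex x)

  convex-⁺-sep : ∀ {A B} → Convex 𝐋 P A → Convex 𝐋 P B →
                 _⁺ 𝐋 E A B ≡ 𝟙 → _≗ᴸ_ 𝐋 A B
  convex-⁺-sep {A} {B} A-convex B-convex E⁺≡𝟙 x = ≤-antisym
    (≤-trans (𝟙≤S⇒⊆ (≤-trans 𝟙≤E⁺ (∧-lb₁ _ _)) x) (convex-∘ʳ-⊆ E≤P E≤flipP B-convex x))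
    (≤-trans (𝟙≤S⇒⊆ (≤-trans 𝟙≤E⁺ (∧-lb₂ _ _)) x) (convex-ʳ∘-⊆ A-convex x))
    where
    𝟙≤E⁺ : 𝟙 ≤ _⁺ 𝐋 E A B
    𝟙≤E⁺ = ≡⇒≤ (sym E⁺≡𝟙)

  S-convex : ∀ {a} {A V} → Convex 𝐋 P V →
             a ≤ S 𝐋 A (_∘ʳ_ 𝐋 P V) → a ≤ S 𝐋 A (_ʳ∘_ 𝐋 V P) → a ≤ S 𝐋 A V
  S-convex {V = V} V-convex a≤S↓ a≤S↑ = ≤-trans
    (S-∩ a≤S↓ (≤-trans a≤S↑ (S-monoʳ (λ x → ⋁-⊗-comm V (λ y → P y x)))))
    (S-monoʳ (λ x → ≡⇒≤ (sym (V-convex x))))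

  convex-⁺-antisym : ∀ {A B} → Convex 𝐋 P A → Convex 𝐋 P B →
                     _⁺ 𝐋 P A B ∧ _⁺ 𝐋 P B A ≤ _⁺ 𝐋 E A B
  convex-⁺-antisym {A} {B} A-convex B-convex = ∧-glb
    (≤-trans (S-convex B-convex (≤-trans (∧-lb₁ _ _) (∧-lb₁ _ _))
                                (≤-trans (∧-lb₂ _ _) (∧-lb₂ _ _)))
             (S-monoʳ (⊆-∘ʳ E-refl B)))
    (≤-trans (S-convex A-convex (≤-trans (∧-lb₂ _ _) (∧-lb₁ _ _))
                                (≤-trans (∧-lb₁ _ _) (∧-lb₂ _ _)))
             (S-monoʳ (⊆-ʳ∘ E-refl A)))

  ⁺-compat : ∀ A B A′ B′ → _⁺ 𝐋 P A B ⊗ _⁺ 𝐋 E A A′ ⊗ _⁺ 𝐋 E B B′ ≤ _⁺ 𝐋 P A′ B′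
  ⁺-compat A B A′ B′ = begin
    P⁺ A B ⊗ (E⁺ A A′ ⊗ E⁺ B B′)
      ≤⟨ ⊗-monoʳ (P⁺ A B) (⊗-mono (≤-trans (⁺-flip E A A′) (⁺-mono (λ x y → E≤flipP y x) A′ A))
                                  (⁺-mono E≤P B B′)) ⟩
    P⁺ A B ⊗ (P⁺ A′ A ⊗ P⁺ B B′)   ≡⟨ ⊗-swap _ _ _ ⟩
    P⁺ A′ A ⊗ (P⁺ A B ⊗ P⁺ B B′)   ≤⟨ ⊗-monoʳ (P⁺ A′ A) (⁺-trans P-trans A B B′) ⟩
    P⁺ A′ A ⊗ P⁺ A B′              ≤⟨ ⁺-trans P-trans A′ A B′ ⟩
    P⁺ A′ B′                       ∎
    where
    P⁺ E⁺ : LSet 𝐋 U → LSet 𝐋 U → Carrier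
    P⁺ = _⁺ 𝐋 P
    E⁺ = _⁺ 𝐋 E

theorem7 : (𝐋 : CRL) (U : Set) (E P : U → U → CRL.Carrier 𝐋)
    → IsLOrdered 𝐋 {U} _≡_ E P
    → (InM : LSet 𝐋 U → Set)
    → (∀ V → InM V → Convex 𝐋 P V)
    → IsLOrdered 𝐋 {Σ (LSet 𝐋 U) InM}
        (λ A B → _≗ᴸ_ 𝐋 (proj₁ A) (proj₁ B))
        (λ A B → _⁺ 𝐋 E (proj₁ A) (proj₁ B))
        (λ A B → _⁺ 𝐋 P (proj₁ A) (proj₁ B))
theorem7 𝐋 U E P ord InM convex = record
  { isLEquality = record
    { refl  = λ A → ⁺-refl E-refl (proj₁ A)
    ; sym   = λ A B → ⁺-sym E-sym (proj₁ A) (proj₁ B)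
    ; trans = λ A B C → ⁺-trans E-trans (proj₁ A) (proj₁ B) (proj₁ C)
    ; sep   = λ A B → convex-⁺-sep (convex′ A) (convex′ B)
    }
  ; refl    = λ A → ⁺-refl P-refl (proj₁ A)
  ; trans   = λ A B C → ⁺-trans P-trans (proj₁ A) (proj₁ B) (proj₁ C)
  ; compat  = λ A B A′ B′ → ⁺-compat (proj₁ A) (proj₁ B) (proj₁ A′) (proj₁ B′)
  ; antisym = λ A B → convex-⁺-antisym (convex′ A) (convex′ B)
  }
  where
  open PowerRelation 𝐋
  open ConvexSets 𝐋 ord
  open IsLOrdered ord using (isLEquality) renaming (refl to P-refl; trans to P-trans)
  open IsLEquality isLEquality renaming (refl to E-refl; sym to E-sym; trans to E-trans)

  convex′ : (A : Σ (LSet 𝐋 U) InM) → Convex 𝐋 P (proj₁ A)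
  convex′ (V , V∈M) = convex V V∈M
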